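{- Let $C$ be a $3$-tangle shadow (the generator of Ashley's chain sinnet) whose bracket is $\langle C\rangle=(x+2)\langle 1_3\rangle+(x+2)\langle U_1\rangle+\langle U_2\rangle+\langle s\rangle$, and let $C_n=CC\cdots C$ ($n$ factors, $C_0=1_3$). Then for all $n\ge0$ \[\langle\overline{C_n}\rangle=x(x^2-2)(x+2)^n+x\left(\left(\tfrac{x^2+5x+5-\sqrt{x^4+2x^3+3x^2+10x+9}}{2}\right)^n+\left(\tfrac{x^2+5x+5+\sqrt{x^4+2x^3+3x^2+10x+9}}{2}\right)^n\right),\] and \[\sum_{n\ge0}\langle\overline{C_n}\rangle y^n=\frac{x\big((-x^2-5x-5)y+2\big)}{(2x^3+8x^2+10x+4)y^2+(-x^2-5x-5)y+1}+\frac{x(x^2-2)}{1-(x+2)y}.\]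
   Context: A $3$-tangle shadow is a tangle diagram in a rectangle with three endpoints on the top edge and three on the bottom edge, whose crossings are flat (no over/under information); it may contain closed components. The product $XY$ is concatenation (stacking in a fixed order). The closure $\overline{X}$ joins the $i$-th top endpoint to the $i$-th bottom endpoint ($i=1,2,3$) by parallel arcs without new crossings. A state of a shadow is a choice at each crossing of one of the two smoothings; for a link shadow $K$, $\langle K\rangle=\sum_S x^{|S|}\in\mathbb{Z}[x]$, $|S|$ the number of loops of $S$. Crossingless $3$-tangles modulo closed loops form $\mathcal{D}_3=\{1_3,U_1,U_2,r,s\}$: $1_3$ is three vertical strands; $U_1$ consists of an arc joining top endpoints $1,2$, an arc joining bottom endpoints $1,2$, and a vertical strand at position $3$; $U_2$ is the same with positions $2,3$; $r:=U_1U_2$, $s:=U_2U_1$. Every state of a $3$-tangle shadow $B$ is $\bigcirc^k\sqcup U$ with $k$ loops and $U\in\mathcal{D}_3$, and $\langle B\rangle=\sum_S x^k\langle U\rangle$, a formal $\mathbb{Z}[x]$-linear combination of $\langle 1_3\rangle,\langle U_1\rangle,\langle U_2\rangle,\langle r\rangle,\langle s\rangle$. The generating function is a formal power series in $y$. -}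

module Defs where

open import Data.Nat using (ℕ; zero; suc)
open import Data.Integer using (ℤ; +_; -[1+_])
open import Data.Rational using (ℚ; 0ℚ; 1ℚ; ½; _/_)
  renaming (_+_ to _+ℚ_; _*_ to _*ℚ_; -_ to -ℚ_)
open import Data.List using (List; []; _∷_)
open import Data.Product using (_×_; _,_; proj₁; proj₂)
open import Relation.Binary.PropositionalEquality using (_≡_)

-- Polynomials in x with rational coefficients (lowest degree first).
-- Equality is coefficientwise, so trailing zeros are irrelevant.

Poly : Set
Poly = List ℚ

coeff : Poly → ℕ → ℚ
coeff []      _       = 0ℚ
coeff (a ∷ p) zero    = a
coeff (a ∷ p) (suc k) = coeff p k

infix 4 _≈P_
_≈P_ : Poly → Poly → Set
p ≈P q = ∀ k → coeff p k ≡ coeff q k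

infixl 6 _+P_
_+P_ : Poly → Poly → Poly
[]      +P q       = q
(a ∷ p) +P []      = a ∷ p
(a ∷ p) +P (b ∷ q) = (a +ℚ b) ∷ (p +P q)

scaleP : ℚ → Poly → Poly
scaleP c []      = []
scaleP c (a ∷ p) = (c *ℚ a) ∷ scaleP c p

negP : Poly → Poly
negP = scaleP (-ℚ 1ℚ)

infixl 7 _*P_
_*P_ : Poly → Poly → Poly
[]      *P q = []
(a ∷ p) *P q = scaleP a q +P (0ℚ ∷ (p *P q))

powP : Poly → ℕ → Poly
powP p zero    = 1ℚ ∷ []
powP p (suc n) = p *P powP p n

int : ℤ → ℚ
int z = z / 1

X : Poly
X = 0ℚ ∷ 1ℚ ∷ []

-- The crossingless 3-tangles modulo loops, D₃ = {1₃, U₁, U₂, r, s},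
-- with r = U₁U₂, s = U₂U₁.

data D3 : Set where
  one U1 U2 r s : D3

-- Stacking: u · v = ○^k ⊔ w  is encoded as  (k , w).
-- (Temperley–Lieb relations U_i² = ○U_i, U₁U₂U₁ = U₁, U₂U₁U₂ = U₂.)
mulD : D3 → D3 → ℕ × D3
mulD one v   = 0 , v
mulD u   one = 0 , u
mulD U1 U1 = 1 , U1
mulD U1 U2 = 0 , r
mulD U1 r  = 1 , r
mulD U1 s  = 0 , U1
mulD U2 U1 = 0 , s
mulD U2 U2 = 1 , U2
mulD U2 r  = 0 , U2
mulD U2 s  = 1 , s
mulD r  U1 = 0 , U1
mulD r  U2 = 1 , r
mulD r  r  = 0 , r
mulD r  s  = 1 , U1
mulD s  U1 = 1 , s
mulD s  U2 = 0 , U2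
mulD s  r  = 1 , U2
mulD s  s  = 0 , s

closeLoops : D3 → ℕ
closeLoops one = 3
closeLoops U1  = 2
closeLoops U2  = 2
closeLoops r   = 1
closeLoops s   = 1

allD : List D3
allD = one ∷ U1 ∷ U2 ∷ r ∷ s ∷ []

eqD : D3 → D3 → Poly → Poly
eqD one one p = p
eqD U1  U1  p = p
eqD U2  U2  p = p
eqD r   r   p = p
eqD s   s   p = p
eqD _   _   p = []

sumL : {A : Set} → (A → Poly) → List A → Poly
sumL f []       = []
sumL f (a ∷ as) = f a +P sumL f as

-- Brackets of 3-tangle shadows: formal combinations
--   Σ_{U ∈ D₃} f(U) ⟨U⟩ ,  f(U) a polynomial in x.

Br : Set
Br = D3 → Poly

-- bracket of the product (concatenation) XY from ⟨X⟩, ⟨Y⟩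
_⋆_ : Br → Br → Br
(f ⋆ g) w = sumL (λ u → sumL (λ v →
              eqD (proj₂ (mulD u v)) w
                 (powP X (proj₁ (mulD u v)) *P (f u *P g v))) allD) allD

unitBr : Br
unitBr one = 1ℚ ∷ []
unitBr _   = []

powBr : Br → ℕ → Br
powBr f zero    = unitBr
powBr f (suc n) = f ⋆ powBr f n

closeBr : Br → Poly
closeBr f = sumL (λ u → powP X (closeLoops u) *P f u) allD

xPlus2 : Poly
xPlus2 = int (+ 2) ∷ 1ℚ ∷ []

bracketC : Br
bracketC one = xPlus2
bracketC U1  = xPlus2
bracketC U2  = 1ℚ ∷ []
bracketC r   = []
bracketC s   = 1ℚ ∷ []

-- ℚ[x][√Δ] with Δ = x⁴+2x³+3x²+10x+9 : pairs (p , q) ↦ p + q √Δ.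

Δ : Poly
Δ = int (+ 9) ∷ int (+ 10) ∷ int (+ 3) ∷ int (+ 2) ∷ 1ℚ ∷ []

QE : Set
QE = Poly × Poly

infix 4 _≈Q_
_≈Q_ : QE → QE → Set
(p , q) ≈Q (p' , q') = (p ≈P p') × (q ≈P q')

infixl 6 _+Q_
_+Q_ : QE → QE → QE
(p , q) +Q (p' , q') = (p +P p') , (q +P q')

infixl 7 _*Q_
_*Q_ : QE → QE → QE
(p , q) *Q (p' , q') = (p *P p' +P Δ *P (q *P q')) , (p *P q' +P q *P p')

powQ : QE → ℕ → QE
powQ a zero    = (1ℚ ∷ []) , []
powQ a (suc n) = a *Q powQ a n

embed : Poly → QE
embed p = p , []

Pq : Poly
Pq = int (+ 5) ∷ int (+ 5) ∷ 1ℚ ∷ []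

rootMinus rootPlus : QE
rootMinus = scaleP ½ Pq , scaleP ½ (negP (1ℚ ∷ []))
rootPlus  = scaleP ½ Pq , scaleP ½ (1ℚ ∷ [])

xx2m2 : Poly
xx2m2 = X *P (int -[1+ 1 ] ∷ 0ℚ ∷ 1ℚ ∷ [])

FPS : Set
FPS = ℕ → Poly

infixl 6 _+S_
_+S_ : FPS → FPS → FPS
(F +S G) n = F n +P G n

fromYPoly : List Poly → FPS
fromYPoly []       n       = []
fromYPoly (a ∷ as) zero    = a
fromYPoly (a ∷ as) (suc n) = fromYPoly as n

-- conv D [q_n, …, q_0] = Σ_{j=0}^{n} D_{j+1} q_{n-j}
conv : FPS → List Poly → Poly
conv D []       = []
conv D (q ∷ qs) = D 1 *P q +P conv (λ k → D (suc k)) qs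

-- quotient N / D for a series D with constant term 1:
-- q_n = N_n - Σ_{k=1}^{n} D_k q_{n-k}; quots N D n = [q_n, …, q_0]
quots : FPS → FPS → ℕ → List Poly
quots N D zero    = N 0 ∷ []
quots N D (suc n) = (N (suc n) +P negP (conv D (quots N D n))) ∷ quots N D n

headP : List Poly → Poly
headP []      = []
headP (p ∷ _) = p

divS : FPS → FPS → FPS
divS N D n = headP (quots N D n)

-- Write vₙ = ⟨Cⁿ⟩ as a vector of five polynomials (the coefficients of ⟨1₃⟩, ⟨U₁⟩,
-- ⟨U₂⟩, ⟨r⟩, ⟨s⟩).  Since the bracket of a product is bilinear, vₙ₊₁ = L vₙ for the
-- 5×5 transfer matrix L of left multiplication by ⟨C⟩ over ℚ[x].  Two facts about L
-- carry the whole argument: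
--   * the ⟨1₃⟩-row of L is (x+2, 0, 0, 0, 0), so vₙ(1₃) = (x+2)ⁿ;
--   * the functional φ(g) = closure(g) − x(x²−2)·g(1₃) satisfies the polynomial identity
--     φ(L²g) = P·φ(Lg) − Q·φ(g),  with P = x²+5x+5 and Q = 2x³+8x²+10x+4.
-- Hence ⟨closure(Cⁿ)⟩ = x(x²−2)(x+2)ⁿ + δₙ where δₙ = φ(vₙ) solves the linear recurrence
-- sₙ₊₂ = P sₙ₊₁ − Q sₙ.  A solution of that recurrence is determined by two initial
-- terms, and both x·(ρ₋ⁿ + ρ₊ⁿ), for the two roots ρ± = (P ± √Δ)/2 of t² − Pt + Q in
-- ℚ[x][√Δ], and the coefficients of x(2 − Py)/(1 − Py + Qy²) are such solutions with
-- the same initial terms as δ.  The term x(x²−2)(x+2)ⁿ is the coefficient sequence of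
-- the geometric series x(x²−2)/(1 − (x+2)y).
module Submission where

open import Defs
open import Data.Nat using (ℕ; zero; suc)
open import Data.Integer using (+_)
open import Data.List using (List; []; _∷_)
open import Data.Product using (_×_; _,_; proj₁; proj₂)
open import Data.Rational using (ℚ; 0ℚ; 1ℚ)
  renaming (_+_ to _+ℚ_; _*_ to _*ℚ_; -_ to -ℚ_)
import Data.Rational.Properties as ℚP
open import Data.Maybe using (Maybe; just; nothing; is-just; to-witness-T)
open import Data.Bool using (T)
open import Relation.Nullary using (yes; no)
open import Relation.Binary.PropositionalEquality
open import Algebra.Bundles using (CommutativeRing)
import Algebra.Solver.Ring.AlmostCommutativeRing as ACR

-- _≈P_ is a function type, which Agda cannot use to infer implicit arguments;
-- wrapping it in a record makes the equality usable as a setoid relation.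
infix 4 _≋_
record _≋_ (p q : Poly) : Set where
  constructor mk
  field get : p ≈P q
open _≋_ public

≋-refl : ∀ {p} → p ≋ p
≋-refl = mk λ k → refl

≋-sym : ∀ {p q} → p ≋ q → q ≋ p
≋-sym (mk e) = mk λ k → sym (e k)

≋-trans : ∀ {p q t} → p ≋ q → q ≋ t → p ≋ t
≋-trans (mk e) (mk f) = mk λ k → trans (e k) (f k)

≡⇒≋ : ∀ {p q} → p ≡ q → p ≋ q
≡⇒≋ refl = ≋-refl

∷-cong : ∀ {a b p q} → a ≡ b → p ≋ q → (a ∷ p) ≋ (b ∷ q)
∷-cong e (mk f) = mk λ { zero → e ; (suc k) → f k }

coeff-+ : ∀ p q k → coeff (p +P q) k ≡ coeff p k +ℚ coeff q k
coeff-+ []      q       k       = sym (ℚP.+-identityˡ _)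
coeff-+ (a ∷ p) []      k       = sym (ℚP.+-identityʳ _)
coeff-+ (a ∷ p) (b ∷ q) zero    = refl
coeff-+ (a ∷ p) (b ∷ q) (suc k) = coeff-+ p q k

coeff-scale : ∀ c p k → coeff (scaleP c p) k ≡ c *ℚ coeff p k
coeff-scale c []      k       = sym (ℚP.*-zeroʳ c)
coeff-scale c (a ∷ p) zero    = refl
coeff-scale c (a ∷ p) (suc k) = coeff-scale c p k

+-cong : ∀ {p p' q q'} → p ≋ p' → q ≋ q' → p +P q ≋ p' +P q'
+-cong {p} {p'} {q} {q'} (mk e) (mk f) = mk λ k →
  trans (coeff-+ p q k) (trans (cong₂ _+ℚ_ (e k) (f k)) (sym (coeff-+ p' q' k)))

+-assoc : ∀ p q t → (p +P q) +P t ≋ p +P (q +P t)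
+-assoc p q t = mk λ k → let open ≡-Reasoning in begin
  coeff ((p +P q) +P t) k                ≡⟨ coeff-+ (p +P q) t k ⟩
  coeff (p +P q) k +ℚ coeff t k          ≡⟨ cong (_+ℚ coeff t k) (coeff-+ p q k) ⟩
  (coeff p k +ℚ coeff q k) +ℚ coeff t k  ≡⟨ ℚP.+-assoc (coeff p k) (coeff q k) (coeff t k) ⟩
  coeff p k +ℚ (coeff q k +ℚ coeff t k)  ≡⟨ cong (coeff p k +ℚ_) (sym (coeff-+ q t k)) ⟩
  coeff p k +ℚ coeff (q +P t) k          ≡⟨ sym (coeff-+ p (q +P t) k) ⟩
  coeff (p +P (q +P t)) k                ∎

+-comm : ∀ p q → p +P q ≋ q +P p
+-comm p q = mk λ k →
  trans (coeff-+ p q k) (trans (ℚP.+-comm (coeff p k) (coeff q k)) (sym (coeff-+ q p k)))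

+-identityʳ : ∀ p → p +P [] ≋ p
+-identityʳ []      = ≋-refl
+-identityʳ (a ∷ p) = ≋-refl

+-interchange : ∀ a b c d → (a +P b) +P (c +P d) ≋ (a +P c) +P (b +P d)
+-interchange a b c d = ≋-trans (+-assoc a b (c +P d))
  (≋-trans (+-cong (≋-refl {a}) (≋-trans (≋-sym (+-assoc b c d))
    (≋-trans (+-cong (+-comm b c) (≋-refl {d})) (+-assoc c b d))))
  (≋-sym (+-assoc a c (b +P d))))

scale-cong : ∀ c {p q} → p ≋ q → scaleP c p ≋ scaleP c q
scale-cong c {p} {q} (mk e) = mk λ k →
  trans (coeff-scale c p k) (trans (cong (c *ℚ_) (e k)) (sym (coeff-scale c q k)))

scale-distrib : ∀ c p q → scaleP c (p +P q) ≋ scaleP c p +P scaleP c q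
scale-distrib c p q = mk λ k → let open ≡-Reasoning in begin
  coeff (scaleP c (p +P q)) k                    ≡⟨ coeff-scale c (p +P q) k ⟩
  c *ℚ coeff (p +P q) k                          ≡⟨ cong (c *ℚ_) (coeff-+ p q k) ⟩
  c *ℚ (coeff p k +ℚ coeff q k)                  ≡⟨ ℚP.*-distribˡ-+ c (coeff p k) (coeff q k) ⟩
  c *ℚ coeff p k +ℚ c *ℚ coeff q k               ≡⟨ sym (cong₂ _+ℚ_ (coeff-scale c p k) (coeff-scale c q k)) ⟩
  coeff (scaleP c p) k +ℚ coeff (scaleP c q) k   ≡⟨ sym (coeff-+ (scaleP c p) (scaleP c q) k) ⟩
  coeff (scaleP c p +P scaleP c q) k             ∎

scale-scale : ∀ a b p → scaleP (a *ℚ b) p ≋ scaleP a (scaleP b p)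
scale-scale a b p = mk λ k → trans (coeff-scale (a *ℚ b) p k) (trans (ℚP.*-assoc a b (coeff p k))
  (trans (cong (a *ℚ_) (sym (coeff-scale b p k))) (sym (coeff-scale a (scaleP b p) k))))

scale-zero : ∀ p → scaleP 0ℚ p ≋ []
scale-zero p = mk λ k → trans (coeff-scale 0ℚ p k) (ℚP.*-zeroˡ (coeff p k))

scale-one : ∀ p → scaleP 1ℚ p ≋ p
scale-one p = mk λ k → trans (coeff-scale 1ℚ p k) (ℚP.*-identityˡ (coeff p k))

shift-+ : ∀ p q → (0ℚ ∷ (p +P q)) ≋ (0ℚ ∷ p) +P (0ℚ ∷ q)
shift-+ p q = mk λ { zero → sym (ℚP.+-identityˡ 0ℚ) ; (suc k) → refl }

shift-zero : ∀ {p} → p ≋ [] → (0ℚ ∷ p) ≋ []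
shift-zero (mk e) = mk λ { zero → refl ; (suc k) → e k }

scale-shift : ∀ c p → scaleP c (0ℚ ∷ p) ≋ (0ℚ ∷ scaleP c p)
scale-shift c p = mk λ { zero → ℚP.*-zeroʳ c ; (suc k) → refl }

*-zeroʳ : ∀ p → p *P [] ≋ []
*-zeroʳ []      = ≋-refl
*-zeroʳ (a ∷ p) = shift-zero (*-zeroʳ p)

*-congʳ : ∀ p {q q'} → q ≋ q' → p *P q ≋ p *P q'
*-congʳ []      e = ≋-refl
*-congʳ (a ∷ p) e = +-cong (scale-cong a e) (∷-cong refl (*-congʳ p e))

*-consʳ : ∀ p b q → p *P (b ∷ q) ≋ scaleP b p +P (0ℚ ∷ (p *P q))
*-consʳ []      b q = ≋-sym (shift-zero ≋-refl)
*-consʳ (a ∷ p) b q = ∷-cong (trans (ℚP.+-identityʳ _) (trans (ℚP.*-comm a b) (sym (ℚP.+-identityʳ _))))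
  (≋-trans (+-cong (≋-refl {scaleP a q}) (*-consʳ p b q))
  (≋-trans (≋-sym (+-assoc (scaleP a q) (scaleP b p) _))
  (≋-trans (+-cong (+-comm (scaleP a q) (scaleP b p)) ≋-refl)
   (+-assoc (scaleP b p) (scaleP a q) _))))

*-comm : ∀ p q → p *P q ≋ q *P p
*-comm []      q = ≋-sym (*-zeroʳ q)
*-comm (a ∷ p) q = ≋-trans (+-cong ≋-refl (∷-cong refl (*-comm p q))) (≋-sym (*-consʳ q a p))

*-congˡ : ∀ {p p'} q → p ≋ p' → p *P q ≋ p' *P q
*-congˡ {p} {p'} q e = ≋-trans (*-comm p q) (≋-trans (*-congʳ q e) (*-comm q p'))

*-cong : ∀ {p p' q q'} → p ≋ p' → q ≋ q' → p *P q ≋ p' *P q'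
*-cong {p} {p'} {q} {q'} e f = ≋-trans (*-congˡ q e) (*-congʳ p' f)

*-distribˡ : ∀ p q t → p *P (q +P t) ≋ p *P q +P p *P t
*-distribˡ []      q t = ≋-refl
*-distribˡ (a ∷ p) q t =
  ≋-trans (+-cong (scale-distrib a q t) (≋-trans (∷-cong refl (*-distribˡ p q t)) (shift-+ (p *P q) (p *P t))))
          (+-interchange (scaleP a q) (scaleP a t) (0ℚ ∷ (p *P q)) (0ℚ ∷ (p *P t)))

*-distribʳ : ∀ p q t → (q +P t) *P p ≋ q *P p +P t *P p
*-distribʳ p q t = ≋-trans (*-comm (q +P t) p)
  (≋-trans (*-distribˡ p q t) (+-cong (*-comm p q) (*-comm p t)))

scale-*ˡ : ∀ a q t → scaleP a q *P t ≋ scaleP a (q *P t)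
scale-*ˡ a []      t = ≋-refl
scale-*ˡ a (b ∷ q) t = ≋-trans (+-cong (scale-scale a b t) (∷-cong refl (scale-*ˡ a q t)))
  (≋-trans (+-cong ≋-refl (≋-sym (scale-shift a (q *P t)))) (≋-sym (scale-distrib a (scaleP b t) _)))

*-assoc : ∀ p q t → (p *P q) *P t ≋ p *P (q *P t)
*-assoc []      q t = ≋-refl
*-assoc (a ∷ p) q t = ≋-trans (*-distribʳ t (scaleP a q) _)
  (+-cong (scale-*ˡ a q t)
    (≋-trans (+-cong {p' = []} (scale-zero t) ≋-refl) (∷-cong refl (*-assoc p q t))))

*-identityˡ : ∀ p → (1ℚ ∷ []) *P p ≋ p
*-identityˡ p = ≋-trans (+-cong (scale-one p) (shift-zero ≋-refl)) (+-identityʳ p)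

*-identityʳ : ∀ p → p *P (1ℚ ∷ []) ≋ p
*-identityʳ p = ≋-trans (*-comm p _) (*-identityˡ p)

negP-cong : ∀ {p q} → p ≋ q → negP p ≋ negP q
negP-cong = scale-cong (-ℚ 1ℚ)

negP-inverseʳ : ∀ p → p +P negP p ≋ []
negP-inverseʳ p = mk λ k → let open ≡-Reasoning in begin
  coeff (p +P negP p) k                  ≡⟨ coeff-+ p (negP p) k ⟩
  coeff p k +ℚ coeff (negP p) k          ≡⟨ cong (coeff p k +ℚ_) (coeff-scale (-ℚ 1ℚ) p k) ⟩
  coeff p k +ℚ (-ℚ 1ℚ) *ℚ coeff p k      ≡⟨ cong (coeff p k +ℚ_) (sym (ℚP.neg-distribˡ-* 1ℚ (coeff p k))) ⟩
  coeff p k +ℚ -ℚ (1ℚ *ℚ coeff p k)      ≡⟨ cong (λ t → coeff p k +ℚ -ℚ t) (ℚP.*-identityˡ (coeff p k)) ⟩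
  coeff p k +ℚ -ℚ (coeff p k)            ≡⟨ ℚP.+-inverseʳ (coeff p k) ⟩
  0ℚ                                     ∎

PolyRing : CommutativeRing _ _
PolyRing = record
  { Carrier = Poly
  ; _≈_ = _≋_
  ; _+_ = _+P_
  ; _*_ = _*P_
  ; -_ = negP
  ; 0# = []
  ; 1# = 1ℚ ∷ []
  ; isCommutativeRing = record
    { isRing = record
      { +-isAbelianGroup = record
        { isGroup = record
          { isMonoid = record
            { isSemigroup = record
              { isMagma = record
                { isEquivalence = record { refl = ≋-refl ; sym = ≋-sym ; trans = ≋-trans }
                ; ∙-cong = +-cong }
              ; assoc = +-assoc }
            ; identity = (λ p → ≋-refl) , +-identityʳ }
          ; inverse = (λ p → ≋-trans (+-comm (negP p) p) (negP-inverseʳ p)) , negP-inverseʳ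
          ; ⁻¹-cong = negP-cong }
        ; comm = +-comm }
      ; *-cong = *-cong
      ; *-assoc = *-assoc
      ; *-identity = *-identityˡ , *-identityʳ
      ; distrib = *-distribˡ , *-distribʳ }
    ; *-comm = *-comm }
  }

cP : ℚ → Poly
cP a = a ∷ []

constants : CommutativeRing.rawRing ℚP.+-*-commutativeRing ACR.-Raw-AlmostCommutative⟶
            ACR.fromCommutativeRing PolyRing
constants = record
  { ⟦_⟧    = cP
  ; +-homo = λ a b → ≋-refl
  ; *-homo = λ a b → mk λ { zero → sym (ℚP.+-identityʳ _) ; (suc k) → refl }
  ; -‿homo = λ a → mk λ { zero → trans (cong -ℚ_ (sym (ℚP.*-identityˡ a))) (ℚP.neg-distribˡ-* 1ℚ a)
                        ; (suc k) → refl }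
  ; 0-homo = mk λ { zero → refl ; (suc k) → refl }
  ; 1-homo = ≋-refl }

constant-equality? : ∀ a b → Maybe (cP a ≋ cP b)
constant-equality? a b with a ℚP.≟ b
... | yes e = just (mk λ k → cong (λ t → coeff (cP t) k) e)
... | no _  = nothing

open import Algebra.Solver.Ring (CommutativeRing.rawRing ℚP.+-*-commutativeRing)
  (ACR.fromCommutativeRing PolyRing) constants constant-equality?

closed-equality? : ∀ p q → Maybe (p ≈P q)
closed-equality? []      []      = just λ k → refl
closed-equality? []      (b ∷ q) with b ℚP.≟ 0ℚ | closed-equality? [] q
... | yes e | just f = just λ { zero → sym e ; (suc k) → f k }
... | _     | _      = nothing
closed-equality? (a ∷ p) []      with a ℚP.≟ 0ℚ | closed-equality? p []
... | yes e | just f = just λ { zero → e ; (suc k) → f k }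
... | _     | _      = nothing
closed-equality? (a ∷ p) (b ∷ q) with a ℚP.≟ b | closed-equality? p q
... | yes e | just f = just λ { zero → e ; (suc k) → f k }
... | _     | _      = nothing

byComputation : ∀ p q → {T (is-just (closed-equality? p q))} → p ≋ q
byComputation p q {t} = mk (to-witness-T (closed-equality? p q) t)

module LinearRecurrence (p q : Poly) where

  Solves : (ℕ → Poly) → Set
  Solves f = ∀ n → f (suc (suc n)) ≋ p *P f (suc n) +P negP (q *P f n)

  unique : ∀ {f h} → Solves f → Solves h → f 0 ≋ h 0 → f 1 ≋ h 1 → ∀ n → f n ≋ h n
  unique {f} {h} sf sh e₀ e₁ n = proj₁ (consecutive n)
    where
    consecutive : ∀ n → (f n ≋ h n) × (f (suc n) ≋ h (suc n))
    consecutive zero    = e₀ , e₁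
    consecutive (suc n) with consecutive n
    ... | eₙ , eₙ₊₁ = eₙ₊₁ , ≋-trans (sf n)
      (≋-trans (+-cong (*-congʳ p eₙ₊₁) (negP-cong (*-congʳ q eₙ))) (≋-sym (sh n)))

  zero-solves : Solves (λ _ → [])
  zero-solves n = ≋-sym (+-cong (*-zeroʳ p) (negP-cong (*-zeroʳ q)))

  +-solves : ∀ {f h} → Solves f → Solves h → Solves (λ n → f n +P h n)
  +-solves {f} {h} sf sh n = ≋-trans (+-cong (sf n) (sh n))
    (linear p q (f n) (f (suc n)) (h n) (h (suc n)))
    where
    linear : ∀ p q a₀ a₁ b₀ b₁ →
      (p *P a₁ +P negP (q *P a₀)) +P (p *P b₁ +P negP (q *P b₀))
        ≋ p *P (a₁ +P b₁) +P negP (q *P (a₀ +P b₀))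
    linear = solve 6 (λ p q a₀ a₁ b₀ b₁ →
      (p :* a₁ :+ :- (q :* a₀)) :+ (p :* b₁ :+ :- (q :* b₀))
        := p :* (a₁ :+ b₁) :+ :- (q :* (a₀ :+ b₀))) ≋-refl

  scale-solves : ∀ c {f} → Solves f → Solves (λ n → c *P f n)
  scale-solves c {f} sf n = ≋-trans (*-congʳ c (sf n)) (linear c p q (f n) (f (suc n)))
    where
    linear : ∀ c p q a₀ a₁ →
      c *P (p *P a₁ +P negP (q *P a₀)) ≋ p *P (c *P a₁) +P negP (q *P (c *P a₀))
    linear = solve 5 (λ c p q a₀ a₁ →
      c :* (p :* a₁ :+ :- (q :* a₀)) := p :* (c :* a₁) :+ :- (q :* (c :* a₀))) ≋-refl

  -- If a ± b√Δ are the roots of t² − p t + q (i.e. 2a = p and a² − Δb² = q), both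
  -- components of the powers of a + b√Δ in ℚ[x][√Δ] solve the recurrence.
  module ConjugateRoot (a b : Poly) (trace : a +P a ≋ p)
                       (norm : a *P a +P negP (Δ *P (b *P b)) ≋ q) where

    rational-part-solves : Solves (λ n → proj₁ (powQ (a , b) n))
    rational-part-solves n = ≋-trans (square a b Δ (proj₁ (powQ (a , b) n)) (proj₂ (powQ (a , b) n)))
      (+-cong (*-congˡ _ trace) (negP-cong (*-congˡ _ norm)))
      where
      square : ∀ a b d u w →
        a *P (a *P u +P d *P (b *P w)) +P d *P (b *P (a *P w +P b *P u))
          ≋ (a +P a) *P (a *P u +P d *P (b *P w)) +P negP ((a *P a +P negP (d *P (b *P b))) *P u)
      square = solve 5 (λ a b d u w →
        a :* (a :* u :+ d :* (b :* w)) :+ d :* (b :* (a :* w :+ b :* u))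
          := (a :+ a) :* (a :* u :+ d :* (b :* w)) :+ :- ((a :* a :+ :- (d :* (b :* b))) :* u)) ≋-refl

    irrational-part-solves : Solves (λ n → proj₂ (powQ (a , b) n))
    irrational-part-solves n = ≋-trans (square a b Δ (proj₁ (powQ (a , b) n)) (proj₂ (powQ (a , b) n)))
      (+-cong (*-congˡ _ trace) (negP-cong (*-congˡ _ norm)))
      where
      square : ∀ a b d u w →
        a *P (a *P w +P b *P u) +P b *P (a *P u +P d *P (b *P w))
          ≋ (a +P a) *P (a *P w +P b *P u) +P negP ((a *P a +P negP (d *P (b *P b))) *P w)
      square = solve 5 (λ a b d u w →
        a :* (a :* w :+ b :* u) :+ b :* (a :* u :+ d :* (b :* w))
          := (a :+ a) :* (a :* w :+ b :* u) :+ :- ((a :* a :+ :- (d :* (b :* b))) :* w)) ≋-refl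

earlierQuots : FPS → FPS → ℕ → List Poly
earlierQuots N D zero    = []
earlierQuots N D (suc n) = quots N D n

quots-head : ∀ N D n → quots N D n ≡ divS N D n ∷ earlierQuots N D n
quots-head N D zero    = refl
quots-head N D (suc n) = refl

conv-null : ∀ (D : FPS) qs → (∀ k → D (suc k) ≡ []) → conv D qs ≡ []
conv-null D []       z = refl
conv-null D (q ∷ qs) z rewrite z 0 = conv-null (λ k → D (suc k)) qs (λ k → z (suc k))

-- the coefficients of (n₀ + n₁y)/(1 − p y + q y²) solve sₙ₊₂ = p sₙ₊₁ − q sₙ: beyond
-- degree 1 the numerator vanishes and qₙ₊₂ = −(−p)qₙ₊₁ − q qₙ
quotient-solves : ∀ p q n₀ n₁ → LinearRecurrence.Solves p q
  (divS (fromYPoly (n₀ ∷ n₁ ∷ [])) (fromYPoly ((1ℚ ∷ []) ∷ negP p ∷ q ∷ [])))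
quotient-solves p q n₀ n₁ n =
  ≋-trans (≡⇒≋ (cong (λ l → negP (conv D (S (suc n) ∷ l))) (quots-head N D n)))
  (≋-trans (negP-cong (+-cong (≋-refl {negP p *P S (suc n)})
             (≋-trans (+-cong (≋-refl {q *P S n}) (≡⇒≋ (conv-null _ (earlierQuots N D n) λ k → refl)))
                      (+-identityʳ (q *P S n)))))
           (negate p q (S (suc n)) (S n)))
  where
  N D : FPS
  N = fromYPoly (n₀ ∷ n₁ ∷ [])
  D = fromYPoly ((1ℚ ∷ []) ∷ negP p ∷ q ∷ [])
  S : ℕ → Poly
  S = divS N D
  negate : ∀ p q a b → negP (negP p *P a +P q *P b) ≋ p *P a +P negP (q *P b)
  negate = solve 4 (λ p q a b → :- ((:- p) :* a :+ q :* b) := p :* a :+ :- (q :* b)) ≋-refl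

-- the coefficients of a/(1 − c y) are a·cⁿ, since qₙ₊₁ = c qₙ
geometric : ∀ a c n → divS (fromYPoly (a ∷ [])) (fromYPoly ((1ℚ ∷ []) ∷ negP c ∷ [])) n ≋ a *P powP c n
geometric a c zero    = ≋-sym (*-identityʳ a)
geometric a c (suc n) =
  ≋-trans (≡⇒≋ (cong (λ l → negP (conv D l)) (quots-head N D n)))
  (≋-trans (negP-cong (+-cong (≋-refl {negP c *P S n})
    (≡⇒≋ (conv-null _ (earlierQuots N D n) λ k → refl))))
  (≋-trans (negP-cong (+-identityʳ (negP c *P S n)))
  (≋-trans (next c (S n)) (≋-trans (*-congʳ c (geometric a c n)) (swap c a (powP c n))))))
  where
  N D : FPS
  N = fromYPoly (a ∷ [])
  D = fromYPoly ((1ℚ ∷ []) ∷ negP c ∷ [])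
  S : ℕ → Poly
  S = divS N D
  next : ∀ c s → negP (negP c *P s) ≋ c *P s
  next = solve 2 (λ c s → :- ((:- c) :* s) := c :* s) ≋-refl
  swap : ∀ c a t → c *P (a *P t) ≋ a *P (c *P t)
  swap = solve 3 (λ c a t → c :* (a :* t) := a :* (c :* t)) ≋-refl

byCases : (P : D3 → Set) → P one → P U1 → P U2 → P r → P s → ∀ w → P w
byCases P p₁ p₂ p₃ p₄ p₅ one = p₁
byCases P p₁ p₂ p₃ p₄ p₅ U1  = p₂
byCases P p₁ p₂ p₃ p₄ p₅ U2  = p₃
byCases P p₁ p₂ p₃ p₄ p₅ r   = p₄
byCases P p₁ p₂ p₃ p₄ p₅ s   = p₅

-- The transfer matrix, the closure functional and the constants of the argument,
-- written once over an arbitrary signature so that they can both be evaluated in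
-- ℚ[x] (module Ev) and be read as syntax by the ring solver (module Sy).
module Expressions {A : Set} (_⊕_ _⊗_ : A → A → A) (neg : A → A) (k : ℚ → A) (x : A) where

  combine : (D3 → A) → (D3 → A) → A
  combine c g = (c one ⊗ g one) ⊕ ((c U1 ⊗ g U1) ⊕ ((c U2 ⊗ g U2) ⊕ ((c r ⊗ g r) ⊕ (c s ⊗ g s))))

  x+2 x+1 2x+3 x² x³ : A
  x+2  = x ⊕ k (int (+ 2))
  x+1  = x ⊕ k 1ℚ
  2x+3 = (x ⊕ x) ⊕ k (int (+ 3))
  x²   = x ⊗ x
  x³   = x ⊗ x²

  -- E w v : the coefficient of ⟨w⟩ in ⟨C⟩⟨v⟩
  E : D3 → D3 → A
  E one one = x+2
  E one _   = k 0ℚ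
  E U1 one  = x+2
  E U1 U1   = x+2 ⊗ x+1
  E U1 U2   = k 0ℚ
  E U1 r    = k 0ℚ
  E U1 s    = x+2
  E U2 one  = k 1ℚ
  E U2 U1   = k 0ℚ
  E U2 U2   = 2x+3
  E U2 r    = x+1
  E U2 s    = k 0ℚ
  E r one   = k 0ℚ
  E r U1    = k 0ℚ
  E r U2    = x+2
  E r r     = x+2 ⊗ x+1
  E r s     = k 0ℚ
  E s one   = k 1ℚ
  E s U1    = x+1
  E s U2    = k 0ℚ
  E s r     = k 0ℚ
  E s s     = 2x+3

  L : (D3 → A) → D3 → A
  L g w = combine (E w) g

  closureWeight : D3 → A
  closureWeight one = x³
  closureWeight U1  = x²
  closureWeight U2  = x²
  closureWeight r   = x
  closureWeight s   = x

  closure : (D3 → A) → A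
  closure = combine closureWeight

  A₀ P Q : A
  A₀ = x³ ⊕ neg (k (int (+ 2)) ⊗ x)
  P  = (x² ⊕ (k (int (+ 5)) ⊗ x)) ⊕ k (int (+ 5))
  Q  = (((k (int (+ 2)) ⊗ x³) ⊕ (k (int (+ 8)) ⊗ x²)) ⊕ (k (int (+ 10)) ⊗ x)) ⊕ k (int (+ 4))

  -- the closure with the contribution of the eigenvalue x+2 removed
  φ : (D3 → A) → A
  φ g = closure g ⊕ neg (A₀ ⊗ g one)

-- The solver quantifies over polynomials, so a vector g : D3 → Poly is presented by its
-- five values; tuple (g one) … (g s) agrees with g on every constructor, hence
-- definitionally inside L and φ.
tuple : {A : Set} → A → A → A → A → A → D3 → A
tuple a b c d e = byCases _ a b c d e

module Evaluated (x : Poly) = Expressions _+P_ _*P_ negP cP x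
module Ev = Evaluated X
module Sy {n : ℕ} (x : Polynomial n) = Expressions _:+_ _:*_ :-_ con x

L-one : ∀ g → Ev.L g one ≋ Ev.x+2 *P g one
L-one g = identity X (g one) (g U1) (g U2) (g r) (g s)
  where
  identity : ∀ x a b c d e → Evaluated.L x (tuple a b c d e) one ≋ Evaluated.x+2 x *P a
  identity = solve 6 (λ x a b c d e → Sy.L x (tuple a b c d e) one := Sy.x+2 x :* a) ≋-refl

φ-recurrence : ∀ g → Ev.φ (Ev.L (Ev.L g)) ≋ Ev.P *P Ev.φ (Ev.L g) +P negP (Ev.Q *P Ev.φ g)
φ-recurrence g = identity X (g one) (g U1) (g U2) (g r) (g s)
  where
  identity : ∀ x a b c d e → let open Evaluated x ; t = tuple a b c d e in
    φ (L (L t)) ≋ P *P φ (L t) +P negP (Q *P φ t)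
  identity = solve 6 (λ x a b c d e → let t = tuple a b c d e in
    Sy.φ x (Sy.L x (Sy.L x t)) := Sy.P x :* Sy.φ x (Sy.L x t) :+ :- (Sy.Q x :* Sy.φ x t)) ≋-refl

sumL-cong : ∀ {B : Set} {F G : B → Poly} (l : List B) → (∀ a → F a ≋ G a) → sumL F l ≋ sumL G l
sumL-cong []      e = ≋-refl
sumL-cong (a ∷ l) e = +-cong (e a) (sumL-cong l e)

sumL-+ : ∀ {B : Set} (F G : B → Poly) (l : List B) → sumL (λ a → F a +P G a) l ≋ sumL F l +P sumL G l
sumL-+ F G []      = ≋-refl
sumL-+ F G (a ∷ l) = ≋-trans (+-cong ≋-refl (sumL-+ F G l)) (+-interchange (F a) (G a) (sumL F l) (sumL G l))

sumL-zero : ∀ {B : Set} (l : List B) → sumL (λ _ → []) l ≋ []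
sumL-zero []      = ≋-refl
sumL-zero (a ∷ l) = sumL-zero l

sumL-swap : ∀ {B C : Set} (K : B → C → Poly) (l₁ : List B) (l₂ : List C) →
  sumL (λ u → sumL (K u) l₂) l₁ ≋ sumL (λ v → sumL (λ u → K u v) l₁) l₂
sumL-swap K []       l₂ = ≋-sym (sumL-zero l₂)
sumL-swap K (u ∷ l₁) l₂ = ≋-trans (+-cong ≋-refl (sumL-swap K l₁ l₂))
  (≋-sym (sumL-+ (K u) (λ v → sumL (λ u → K u v) l₁) l₂))

sumL-*ʳ : ∀ {B : Set} (H : B → Poly) q (l : List B) → sumL (λ u → H u *P q) l ≋ sumL H l *P q
sumL-*ʳ H q []      = ≋-refl
sumL-*ʳ H q (a ∷ l) = ≋-trans (+-cong ≋-refl (sumL-*ʳ H q l)) (≋-sym (*-distribʳ q (H a) (sumL H l)))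

reassociate : ∀ p q t → p *P (q *P t) ≋ (p *P q) *P t
reassociate p q t = ≋-sym (*-assoc p q t)

discarded : ∀ (p q t : Poly) → [] ≋ [] *P t
discarded p q t = ≋-refl

-- selecting the ⟨w⟩-component is compatible with reassociating a product: it is the
-- identity on the diagonal and the constant [] off it
eqD-assoc : ∀ e w p q t → eqD e w (p *P (q *P t)) ≋ eqD e w (p *P q) *P t
eqD-assoc one = byCases _ reassociate discarded discarded discarded discarded
eqD-assoc U1  = byCases _ discarded reassociate discarded discarded discarded
eqD-assoc U2  = byCases _ discarded discarded reassociate discarded discarded
eqD-assoc r   = byCases _ discarded discarded discarded reassociate discarded
eqD-assoc s   = byCases _ discarded discarded discarded discarded reassociate

-- transferMatrix f w v : the coefficient of ⟨w⟩ in f ⋆ ⟨v⟩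
transferMatrix : Br → D3 → D3 → Poly
transferMatrix f w v = sumL (λ u → eqD (proj₂ (mulD u v)) w (powP X (proj₁ (mulD u v)) *P f u)) allD

⋆-linear : ∀ f g w → (f ⋆ g) w ≋ sumL (λ v → transferMatrix f w v *P g v) allD
⋆-linear f g w = ≋-trans
  (sumL-cong allD λ u → sumL-cong allD λ v →
     eqD-assoc (proj₂ (mulD u v)) w (powP X (proj₁ (mulD u v))) (f u) (g v))
  (≋-trans (sumL-swap K allD allD)
   (sumL-cong allD λ v → sumL-*ʳ (λ u → eqD (proj₂ (mulD u v)) w (powP X (proj₁ (mulD u v)) *P f u)) (g v) allD))
  where
  K : D3 → D3 → Poly
  K u v = eqD (proj₂ (mulD u v)) w (powP X (proj₁ (mulD u v)) *P f u) *P g v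

sum-over-D3 : ∀ (H H' : D3 → Poly) (g : Br) → (∀ v → H v ≋ H' v) →
  sumL (λ v → H v *P g v) allD ≋ Ev.combine H' g
sum-over-D3 H H' g e =
  +-cong (*-congˡ (g one) (e one)) (+-cong (*-congˡ (g U1) (e U1)) (+-cong (*-congˡ (g U2) (e U2))
  (+-cong (*-congˡ (g r) (e r)) (≋-trans (+-identityʳ (H s *P g s)) (*-congˡ (g s) (e s))))))

transferMatrix-C : ∀ w v → transferMatrix bracketC w v ≋ Ev.E w v
transferMatrix-C one = byCases _ (byComputation _ _) (byComputation _ _) (byComputation _ _) (byComputation _ _) (byComputation _ _)
transferMatrix-C U1  = byCases _ (byComputation _ _) (byComputation _ _) (byComputation _ _) (byComputation _ _) (byComputation _ _)
transferMatrix-C U2  = byCases _ (byComputation _ _) (byComputation _ _) (byComputation _ _) (byComputation _ _) (byComputation _ _)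
transferMatrix-C r   = byCases _ (byComputation _ _) (byComputation _ _) (byComputation _ _) (byComputation _ _) (byComputation _ _)
transferMatrix-C s   = byCases _ (byComputation _ _) (byComputation _ _) (byComputation _ _) (byComputation _ _) (byComputation _ _)

⋆-C : ∀ g w → (bracketC ⋆ g) w ≋ Ev.L g w
⋆-C g w = ≋-trans (⋆-linear bracketC g w) (sum-over-D3 _ (Ev.E w) g (transferMatrix-C w))

closeBr-closure : ∀ f → closeBr f ≋ Ev.closure f
closeBr-closure f = sum-over-D3 (λ u → powP X (closeLoops u)) Ev.closureWeight f
  (byCases _ (byComputation _ _) (byComputation _ _) (byComputation _ _)
             (byComputation _ _) (byComputation _ _))

combine-cong : ∀ c {g h : Br} → (∀ u → g u ≋ h u) → Ev.combine c g ≋ Ev.combine c h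
combine-cong c e = +-cong (*-congʳ (c one) (e one)) (+-cong (*-congʳ (c U1) (e U1))
  (+-cong (*-congʳ (c U2) (e U2)) (+-cong (*-congʳ (c r) (e r)) (*-congʳ (c s) (e s)))))

L-cong : ∀ {g h : Br} → (∀ u → g u ≋ h u) → ∀ w → Ev.L g w ≋ Ev.L h w
L-cong e w = combine-cong (Ev.E w) e

φ-cong : ∀ {g h : Br} → (∀ u → g u ≋ h u) → Ev.φ g ≋ Ev.φ h
φ-cong e = +-cong (combine-cong Ev.closureWeight e) (negP-cong (*-congʳ Ev.A₀ (e one)))

v : ℕ → Br
v = powBr bracketC

v-step : ∀ n w → v (suc n) w ≋ Ev.L (v n) w
v-step n = ⋆-C (v n)

v-one : ∀ n → v n one ≋ powP xPlus2 n
v-one zero    = ≋-refl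
v-one (suc n) = ≋-trans (v-step n one)
  (≋-trans (L-one (v n)) (*-cong (byComputation Ev.x+2 xPlus2) (v-one n)))

Qq : Poly
Qq = int (+ 4) ∷ int (+ 10) ∷ int (+ 8) ∷ int (+ 2) ∷ []

open LinearRecurrence Pq Qq

δ : ℕ → Poly
δ n = Ev.φ (v n)

δ-solves : Solves δ
δ-solves n = ≋-trans (φ-cong (λ w → ≋-trans (v-step (suc n) w) (L-cong (v-step n) w)))
  (≋-trans (φ-recurrence (v n))
    (+-cong (*-cong (byComputation Ev.P Pq) (φ-cong (λ w → ≋-sym (v-step n w))))
            (negP-cong (*-congˡ (δ n) (byComputation Ev.Q Qq)))))

closure-split : ∀ n → closeBr (v n) ≋ xx2m2 *P powP xPlus2 n +P δ n
closure-split n = ≋-trans (closeBr-closure (v n))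
  (≋-trans (split Ev.A₀ (Ev.closure (v n)) (v n one))
           (+-cong (*-cong (byComputation Ev.A₀ xx2m2) (v-one n)) ≋-refl))
  where
  split : ∀ a c g → c ≋ a *P g +P (c +P negP (a *P g))
  split = solve 3 (λ a c g → c := a :* g :+ (c :+ :- (a :* g))) ≋-refl

-- the rational and irrational parts of ρ₋ⁿ + ρ₊ⁿ, where ρ± = (P ± √Δ)/2
σ τ : ℕ → Poly
σ n = proj₁ (powQ rootMinus n) +P proj₁ (powQ rootPlus n)
τ n = proj₂ (powQ rootMinus n) +P proj₂ (powQ rootPlus n)

module ρ₋ = ConjugateRoot (proj₁ rootMinus) (proj₂ rootMinus) (byComputation _ _) (byComputation _ _)
module ρ₊ = ConjugateRoot (proj₁ rootPlus)  (proj₂ rootPlus)  (byComputation _ _) (byComputation _ _)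

σ-solves : Solves σ
σ-solves = +-solves {λ n → proj₁ (powQ rootMinus n)} {λ n → proj₁ (powQ rootPlus n)}
  ρ₋.rational-part-solves ρ₊.rational-part-solves

τ-solves : Solves τ
τ-solves = +-solves {λ n → proj₂ (powQ rootMinus n)} {λ n → proj₂ (powQ rootPlus n)}
  ρ₋.irrational-part-solves ρ₊.irrational-part-solves

δ-roots : ∀ n → δ n ≋ X *P σ n
δ-roots = unique δ-solves (scale-solves X {σ} σ-solves) (byComputation _ _) (byComputation _ _)

τ-vanishes : ∀ n → τ n ≋ []
τ-vanishes = unique τ-solves zero-solves (byComputation _ _) (byComputation _ _)

rootSeries : FPS
rootSeries = divS (fromYPoly (scaleP (int (+ 2)) X ∷ X *P negP Pq ∷ []))
                  (fromYPoly ((1ℚ ∷ []) ∷ negP Pq ∷ Qq ∷ []))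

δ-series : ∀ n → δ n ≋ rootSeries n
δ-series = unique δ-solves (quotient-solves Pq Qq _ _) (byComputation _ _) (byComputation _ _)

mainTheorem6 :
    (∀ (n : ℕ) →
      embed (closeBr (powBr bracketC n))
        ≈Q embed (xx2m2 *P powP xPlus2 n)
           +Q embed X *Q (powQ rootMinus n +Q powQ rootPlus n))
    ×
    (∀ (n : ℕ) →
      closeBr (powBr bracketC n)
        ≈P (divS (fromYPoly (scaleP (int (+ 2)) X ∷ X *P negP Pq ∷ []))
                 (fromYPoly ((1ℚ ∷ []) ∷ negP Pq
                    ∷ (int (+ 4) ∷ int (+ 10) ∷ int (+ 8) ∷ int (+ 2) ∷ []) ∷ []))
            +S divS (fromYPoly (xx2m2 ∷ []))
                    (fromYPoly ((1ℚ ∷ []) ∷ negP xPlus2 ∷ []))) n)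
mainTheorem6 = (λ n → get (closed-form n) , get (irrational-part n)) , (λ n → get (generating-function n))
  where
  closed-form : ∀ n → closeBr (v n) ≋ xx2m2 *P powP xPlus2 n +P (X *P σ n +P Δ *P ([] *P τ n))
  closed-form n = ≋-trans (closure-split n) (+-cong (≋-refl {xx2m2 *P powP xPlus2 n})
    (≋-trans (δ-roots n) (≋-sym (≋-trans (+-cong (≋-refl {X *P σ n}) (*-zeroʳ Δ)) (+-identityʳ (X *P σ n))))))
  irrational-part : ∀ n → [] ≋ X *P τ n +P [] *P σ n
  irrational-part n = ≋-sym (≋-trans (+-identityʳ (X *P τ n)) (≋-trans (*-congʳ X (τ-vanishes n)) (*-zeroʳ X)))
  generating-function : ∀ n → closeBr (v n) ≋ rootSeries n +P
    divS (fromYPoly (xx2m2 ∷ [])) (fromYPoly ((1ℚ ∷ []) ∷ negP xPlus2 ∷ [])) n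
  generating-function n = ≋-trans (closure-split n) (≋-trans (+-comm _ (δ n))
    (+-cong (δ-series n) (≋-sym (geometric xx2m2 xPlus2 n))))
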